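{- Let $c_3 = \sqrt[64]{2\,\theta(64)}$, where $\theta(64) = 39911512393313043466768$ (so $c_3 = 2.279\ldots$). Then for all integers $k \geq 6$ and $n = 2^k$, \[ \theta(n) \geq \frac{c_3^n}{2}. \]
   Context: For a positive integer $n$, let $[n]=\{1,2,\ldots,n\}$. A permutation $(a_1,a_2,\ldots,a_n)$ of $[n]$ is called 3-free if there do not exist indices $i<j<k$ with $a_i + a_k = 2a_j$, i.e., it contains no 3-term arithmetic progression as a subsequence. $\theta(n)$ denotes the number of 3-free permutations of $[n]$. -}

module Defs where

open import Data.Nat using (ℕ; zero; suc; _+_; _*_)
import Data.Nat.Properties as ℕP
open import Data.Fin using (Fin; toℕ; _<_; _<?_)
open import Data.Fin.Properties using (any?; _≟_)
open import Data.Vec using (Vec; []; _∷_; lookup; toList)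
open import Data.List using (List; [_]; concatMap; map; length; filter; allFin)
open import Data.List.Relation.Unary.Unique.Propositional using (Unique)
open import Data.List.Relation.Unary.Unique.DecPropositional using (unique?)
open import Data.Product using (Σ; _×_; _,_)
open import Relation.Nullary using (¬_; Dec)
open import Relation.Nullary.Decidable using (_×-dec_; ¬?)
open import Relation.Binary.PropositionalEquality using (_≡_)

-- A permutation (a_1,…,a_n) of [n] is represented as a vector v : Vec (Fin n) n,
-- where a_{i+1} = 1 + toℕ (lookup v i).  It is a permutation iff its entries are
-- pairwise distinct (n distinct values from an n-element set).
IsPermutation : {n : ℕ} → Vec (Fin n) n → Set
IsPermutation v = Unique (toList v)

entry : {n : ℕ} → Vec (Fin n) n → Fin n → ℕ
entry v i = suc (toℕ (lookup v i))

HasThreeAP : {n : ℕ} → Vec (Fin n) n → Set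
HasThreeAP {n} v =
  Σ (Fin n) λ i → Σ (Fin n) λ j → Σ (Fin n) λ k →
    (i < j) × (j < k) × (entry v i + entry v k ≡ 2 * entry v j)

IsThreeFreePermutation : {n : ℕ} → Vec (Fin n) n → Set
IsThreeFreePermutation v = IsPermutation v × ¬ HasThreeAP v

hasThreeAP? : {n : ℕ} (v : Vec (Fin n) n) → Dec (HasThreeAP v)
hasThreeAP? v =
  any? λ i → any? λ j → any? λ k →
    (i <? j) ×-dec ((j <? k) ×-dec (entry v i + entry v k ℕP.≟ 2 * entry v j))

isThreeFreePermutation? : {n : ℕ} (v : Vec (Fin n) n) → Dec (IsThreeFreePermutation v)
isThreeFreePermutation? v = unique? _≟_ (toList v) ×-dec ¬? (hasThreeAP? v)

allVecs : (m n : ℕ) → List (Vec (Fin m) n)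
allVecs m zero = [ [] ]
allVecs m (suc n) = concatMap (λ x → map (x ∷_) (allVecs m n)) (allFin m)

θ : ℕ → ℕ
θ n = length (filter isThreeFreePermutation? (allVecs n n))

module Submission where

-- The heart of the argument is the doubling inequality 2 θ(n)² ≤ θ(2n) for n ≥ 1.
-- Given 3-free permutations p, q of [n] and a parity r ∈ {0,1}, write the entries
-- of p scaled to the numbers of parity r in [2n] (x ↦ 2x + r, on 0-based values),
-- followed by the entries of q scaled to the opposite parity.  The result is a
-- permutation of [2n]; it is 3-free because a 3-term AP cannot use both blocks (an
-- odd sum is never twice an integer) and an AP inside one block is the image of an
-- AP of p or q under an injective affine map.  Different triples (r, p, q) give
-- different permutations, so θ(2n) ≥ 2 θ(n)².
--
-- Squaring the doubling inequality k - 6 times starting from n = 64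
-- gives (2 θ(64))^(2^(k-6)) ≤ 2 θ(2^k).

open import Defs
open import Function using (_∘_)
open import Data.Nat using (ℕ; zero; suc; _+_; _*_; _^_; _∸_; _≤_; _<_; z≤n; s≤s; NonZero)
open import Data.Nat.Properties
  using ( +-suc; +-identityʳ; *-identityʳ; +-cancelʳ-≡; +-cancelˡ-<; *-cancelˡ-≡
        ; *-mono-≤; *-monoʳ-≤; <-asym; <-≤-trans; m≤m+n; m^n>0; ^-distribˡ-+-*; m+[n∸m]≡n; even≢odd
        ; module ≤-Reasoning )
open import Data.Nat.Tactic.RingSolver using (solve-∀)
open import Data.Fin using (Fin; toℕ; cast; combine; opposite; _↑ˡ_; _↑ʳ_)
  renaming (zero to fzero; suc to fsuc; _<_ to _<ᶠ_)
open import Data.Fin.Properties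
  using (toℕ-injective; toℕ-cast; toℕ-combine; combine-injective; toℕ-↑ˡ; toℕ-↑ʳ; toℕ<n)
open import Data.Vec using (Vec; []; _∷_; lookup; map; _++_; toList)
open import Data.Vec.Properties using (lookup-map; lookup-++ˡ; lookup-++ʳ; toList-++; toList-map; ∷-injective; ∷-injectiveˡ; ++-injective)
open import Data.List using (List; length; filter; allFin; cartesianProduct; cartesianProductWith; concatMap)
import Data.List as List
import Data.List.Properties as ListP
open import Data.List.Relation.Unary.Any using (here; there; _─_; index)
import Data.List.Relation.Unary.All as All
open import Data.List.Relation.Unary.AllPairs using ([]; _∷_)
open import Data.List.Relation.Unary.Unique.Propositional using (Unique)
import Data.List.Relation.Unary.Unique.Propositional.Properties as Unique
open import Data.List.Membership.Propositional using (_∈_)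
import Data.List.Membership.Propositional.Properties as ∈
open import Data.List.Relation.Binary.Subset.Propositional using (_⊆_)
open import Data.Product using (Σ; _×_; _,_; proj₁; proj₂)
open import Data.Sum using (_⊎_; inj₁; inj₂; [_,_])
open import Data.Empty using (⊥-elim)
open import Relation.Nullary using (¬_)
open import Relation.Binary.PropositionalEquality
  using (_≡_; _≢_; refl; sym; trans; cong; cong₂; subst; subst₂; module ≡-Reasoning)

-- Counting with lists

module _ {A : Set} where

  ∈-─ : ∀ {x z} (ys : List A) (x∈ys : x ∈ ys) → z ∈ ys → z ≢ x → z ∈ (ys ─ x∈ys)
  ∈-─ (y List.∷ ys) (here refl) (here refl)   z≢x = ⊥-elim (z≢x refl)
  ∈-─ (y List.∷ ys) (here refl) (there z∈ys)  _   = z∈ys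
  ∈-─ (y List.∷ ys) (there x∈ys) (here z≡y)   _   = here z≡y
  ∈-─ (y List.∷ ys) (there x∈ys) (there z∈ys) z≢x = there (∈-─ ys x∈ys z∈ys z≢x)

  unique-⊆-length : ∀ {xs ys : List A} → Unique xs → xs ⊆ ys → length xs ≤ length ys
  unique-⊆-length {List.[]} _ _ = z≤n
  unique-⊆-length {x List.∷ xs} {ys} (x∉xs ∷ xs-unique) xs⊆ys = begin
      suc (length xs)          ≤⟨ s≤s (unique-⊆-length xs-unique rest⊆ys─x) ⟩
      suc (length (ys ─ x∈ys)) ≡⟨ sym (ListP.length-removeAt′ ys (index x∈ys)) ⟩
      length ys                ∎
    where
    open ≤-Reasoning
    x∈ys : x ∈ ys
    x∈ys = xs⊆ys (here refl)
    rest⊆ys─x : xs ⊆ (ys ─ x∈ys)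
    rest⊆ys─x z∈xs = ∈-─ ys x∈ys (xs⊆ys (there z∈xs)) (λ z≡x → All.lookup x∉xs z∈xs (sym z≡x))

length-cartesianProductWith : ∀ {A B C : Set} (f : A → B → C) (xs : List A) (ys : List B) →
                              length (cartesianProductWith f xs ys) ≡ length xs * length ys
length-cartesianProductWith f List.[] ys = refl
length-cartesianProductWith f (x List.∷ xs) ys = begin
    length (List.map (f x) ys List.++ cartesianProductWith f xs ys)
      ≡⟨ ListP.length-++ (List.map (f x) ys) ⟩
    length (List.map (f x) ys) + length (cartesianProductWith f xs ys)
      ≡⟨ cong₂ _+_ (ListP.length-map (f x) ys) (length-cartesianProductWith f xs ys) ⟩
    length ys + length xs * length ys ∎
  where open ≡-Reasoning

-- Enumerating vectors and 3-free permutations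

allVecs-suc : ∀ m n → allVecs m (suc n) ≡ cartesianProductWith _∷_ (allFin m) (allVecs m n)
allVecs-suc m n = concatMap-product (allFin m)
  where
  concatMap-product : ∀ xs → concatMap (λ x → List.map (x ∷_) (allVecs m n)) xs
                           ≡ cartesianProductWith _∷_ xs (allVecs m n)
  concatMap-product List.[] = refl
  concatMap-product (x List.∷ xs) = cong (List.map (x ∷_) (allVecs m n) List.++_) (concatMap-product xs)

allVecs-unique : ∀ m n → Unique (allVecs m n)
allVecs-unique m zero = All.[] ∷ []
allVecs-unique m (suc n) rewrite allVecs-suc m n =
  Unique.cartesianProductWith⁺ _∷_ ∷-injective (Unique.allFin⁺ m) (allVecs-unique m n)

∈-allVecs : ∀ m n (v : Vec (Fin m) n) → v ∈ allVecs m n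
∈-allVecs m zero [] = here refl
∈-allVecs m (suc n) (x ∷ v) rewrite allVecs-suc m n =
  ∈.∈-cartesianProductWith⁺ _∷_ (∈.∈-allFin x) (∈-allVecs m n v)

threeFree : ∀ n → List (Vec (Fin n) n)
threeFree n = filter isThreeFreePermutation? (allVecs n n)

threeFree-unique : ∀ n → Unique (threeFree n)
threeFree-unique n = Unique.filter⁺ isThreeFreePermutation? (allVecs-unique n n)

∈-threeFree⁻ : ∀ {n} {v : Vec (Fin n) n} → v ∈ threeFree n → IsThreeFreePermutation v
∈-threeFree⁻ {n} v∈ = proj₂ (∈.∈-filter⁻ isThreeFreePermutation? {xs = allVecs n n} v∈)

θ-lower-bound : ∀ n {vs : List (Vec (Fin n) n)} → Unique vs →
                (∀ {v} → v ∈ vs → IsThreeFreePermutation v) → length vs ≤ θ n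
θ-lower-bound n vs-unique vs-free = unique-⊆-length vs-unique
  (λ {v} v∈vs → ∈.∈-filter⁺ isThreeFreePermutation? (∈-allVecs n n v) (vs-free v∈vs))

-- Three-term progressions in sequences of values

-- APBy φ v: along increasing positions i < j < k, the values φ(v_i), φ(v_j), φ(v_k)
-- form an AP.  HasThreeAP v is exactly APBy value v.
APBy : {A : Set} → (A → ℕ) → ∀ {m} → Vec A m → Set
APBy φ {m} v = Σ (Fin m) λ i → Σ (Fin m) λ j → Σ (Fin m) λ k →
  (i <ᶠ j) × (j <ᶠ k) × (φ (lookup v i) + φ (lookup v k) ≡ 2 * φ (lookup v j))

value : ∀ {n} → Fin n → ℕ
value x = suc (toℕ x)

AP-cong : ∀ {a b c a′ b′ c′ : ℕ} → a ≡ a′ → b ≡ b′ → c ≡ c′ → a + c ≡ 2 * b → a′ + c′ ≡ 2 * b′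
AP-cong refl refl refl ap = ap

APBy-map : ∀ {A B : Set} (φ : B → ℕ) (f : A → B) {m} (v : Vec A m) →
           APBy φ (map f v) → APBy (φ ∘ f) v
APBy-map φ f v (i , j , k , i<j , j<k , ap) =
  i , j , k , i<j , j<k , AP-cong (at i) (at j) (at k) ap
  where
  at : ∀ i → φ (lookup (map f v) i) ≡ φ (f (lookup v i))
  at i = cong φ (lookup-map i f v)

APBy-reflect : ∀ {A : Set} (φ ψ : A → ℕ) →
               (∀ a b c → φ a + φ c ≡ 2 * φ b → ψ a + ψ c ≡ 2 * ψ b) →
               ∀ {m} (v : Vec A m) → APBy φ v → APBy ψ v
APBy-reflect φ ψ φ⇒ψ v (i , j , k , i<j , j<k , ap) = i , j , k , i<j , j<k , φ⇒ψ _ _ _ ap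

data Block (m n : ℕ) : Fin (m + n) → Set where
  left  : (i : Fin m) → Block m n (i ↑ˡ n)
  right : (i : Fin n) → Block m n (m ↑ʳ i)

block : ∀ m {n} (i : Fin (m + n)) → Block m n i
block zero i = right i
block (suc m) fzero = left fzero
block (suc m) (fsuc i) with block m i
... | left i′  = left (fsuc i′)
... | right i′ = right i′

↑ˡ<↑ʳ : ∀ {m n} (i : Fin m) (j : Fin n) → i ↑ˡ n <ᶠ m ↑ʳ j
↑ˡ<↑ʳ {m} {n} i j = subst₂ _<_ (sym (toℕ-↑ˡ i n)) (sym (toℕ-↑ʳ m j))
  (<-≤-trans (toℕ<n i) (m≤m+n m (toℕ j)))

↑ˡ-reflects-< : ∀ {m} n {i j : Fin m} → i ↑ˡ n <ᶠ j ↑ˡ n → i <ᶠ j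
↑ˡ-reflects-< n {i} {j} = subst₂ _<_ (toℕ-↑ˡ i n) (toℕ-↑ˡ j n)

↑ʳ-reflects-< : ∀ m {n} {i j : Fin n} → m ↑ʳ i <ᶠ m ↑ʳ j → i <ᶠ j
↑ʳ-reflects-< m {i = i} {j} = +-cancelˡ-< m _ _ ∘ subst₂ _<_ (toℕ-↑ʳ m i) (toℕ-↑ʳ m j)

-- An AP in u ++ w lies entirely in u or entirely in w, provided no value of u plus a
-- value of w is ever even (such a pair could be the outer terms of an AP).
APBy-++ : ∀ {A : Set} (φ : A → ℕ) {m n} (u : Vec A m) (w : Vec A n) →
          (∀ i k z → φ (lookup u i) + φ (lookup w k) ≢ 2 * z) →
          APBy φ (u ++ w) → APBy φ u ⊎ APBy φ w
APBy-++ φ {m} {n} u w no-even-cross (i , j , k , i<j , j<k , ap) =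
  split (block m i) (block m j) (block m k) i<j j<k ap
  where
  inˡ : ∀ i → φ (lookup (u ++ w) (i ↑ˡ n)) ≡ φ (lookup u i)
  inˡ i = cong φ (lookup-++ˡ u w i)
  inʳ : ∀ i → φ (lookup (u ++ w) (m ↑ʳ i)) ≡ φ (lookup w i)
  inʳ i = cong φ (lookup-++ʳ u w i)
  split : ∀ {i j k} → Block m n i → Block m n j → Block m n k → i <ᶠ j → j <ᶠ k →
          φ (lookup (u ++ w) i) + φ (lookup (u ++ w) k) ≡ 2 * φ (lookup (u ++ w) j) →
          APBy φ u ⊎ APBy φ w
  split (left i) (left j) (left k) i<j j<k ap =
    inj₁ (i , j , k , ↑ˡ-reflects-< n i<j , ↑ˡ-reflects-< n j<k , AP-cong (inˡ i) (inˡ j) (inˡ k) ap)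
  split (right i) (right j) (right k) i<j j<k ap =
    inj₂ (i , j , k , ↑ʳ-reflects-< m i<j , ↑ʳ-reflects-< m j<k , AP-cong (inʳ i) (inʳ j) (inʳ k) ap)
  split {j = j} (left i) _ (right k) _ _ ap =
    ⊥-elim (no-even-cross i k (φ (lookup (u ++ w) j)) (AP-cong (inˡ i) (refl {x = φ (lookup (u ++ w) j)}) (inʳ k) ap))
  split (left i)  (right j) (left k) _   j<k _ = ⊥-elim (<-asym (↑ˡ<↑ʳ k j) j<k)
  split (right i) (left j)  _        i<j _   _ = ⊥-elim (<-asym (↑ˡ<↑ʳ j i) i<j)
  split (right i) (right j) (left k) _   j<k _ = ⊥-elim (<-asym (↑ˡ<↑ʳ k j) j<k)

-- Arithmetic of the parity embedding

affine-AP⁻ : ∀ k c {a b d} .{{_ : NonZero k}} →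
             (k * a + c) + (k * d + c) ≡ 2 * (k * b + c) → a + d ≡ 2 * b
affine-AP⁻ k c {a} {b} {d} ap = *-cancelˡ-≡ (a + d) (2 * b) k (+-cancelʳ-≡ _ _ _ (begin
    k * (a + d) + 2 * c       ≡⟨ sym (sum-of-images k c a d) ⟩
    (k * a + c) + (k * d + c) ≡⟨ ap ⟩
    2 * (k * b + c)           ≡⟨ double-image k c b ⟩
    k * (2 * b) + 2 * c       ∎))
  where
  open ≡-Reasoning
  sum-of-images : ∀ k c a d → (k * a + c) + (k * d + c) ≡ k * (a + d) + 2 * c
  sum-of-images = solve-∀
  double-image : ∀ k c b → 2 * (k * b + c) ≡ k * (2 * b) + 2 * c
  double-image = solve-∀

suc-AP : ∀ {a b d} → a + d ≡ 2 * b → suc a + suc d ≡ 2 * suc b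
suc-AP {a} {b} {d} ap = begin
    suc a + suc d   ≡⟨ cong suc (+-suc a d) ⟩
    2 + (a + d)     ≡⟨ cong (2 +_) ap ⟩
    2 + 2 * b       ≡⟨ shift b ⟩
    2 * suc b       ∎
  where
  open ≡-Reasoning
  shift : ∀ b → 2 + 2 * b ≡ 2 * suc b
  shift = solve-∀

parity-sum : ∀ (r : Fin 2) → toℕ r + toℕ (opposite r) ≡ 1
parity-sum fzero = refl
parity-sum (fsuc fzero) = refl

opposite-≢ : ∀ (r : Fin 2) → r ≢ opposite r
opposite-≢ fzero ()
opposite-≢ (fsuc fzero) ()

spread : ∀ {n} → Fin 2 → Fin n → Fin (n + n)
spread {n} r x = cast (twice n) (combine x r)
  where
  twice : ∀ n → n * 2 ≡ n + n
  twice = solve-∀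

toℕ-spread : ∀ {n} r (x : Fin n) → toℕ (spread r x) ≡ 2 * toℕ x + toℕ r
toℕ-spread r x = trans (toℕ-cast _ (combine x r)) (toℕ-combine x r)

spread-injective : ∀ {n} {r s} {x y : Fin n} → spread r x ≡ spread s y → x ≡ y × r ≡ s
spread-injective {r = r} {s} {x} {y} eq = combine-injective x r y s (toℕ-injective (begin
    toℕ (combine x r) ≡⟨ sym (toℕ-cast _ (combine x r)) ⟩
    toℕ (spread r x)  ≡⟨ cong toℕ eq ⟩
    toℕ (spread s y)  ≡⟨ toℕ-cast _ (combine y s) ⟩
    toℕ (combine y s) ∎))
  where open ≡-Reasoning

spread-reflects-AP : ∀ {n} r (a b c : Fin n) →
  value (spread r a) + value (spread r c) ≡ 2 * value (spread r b) → value a + value c ≡ 2 * value b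
spread-reflects-AP r a b c ap = suc-AP (affine-AP⁻ 2 (suc (toℕ r)) {toℕ a} {toℕ b} {toℕ c} (AP-cong (v a) (v b) (v c) ap))
  where
  v : ∀ x → value (spread r x) ≡ 2 * toℕ x + suc (toℕ r)
  v x = trans (cong suc (toℕ-spread r x)) (sym (+-suc (2 * toℕ x) (toℕ r)))

-- Values of opposite parities have an odd sum, which is never twice an integer.
opposite-parities-odd : ∀ {n} r (x y : Fin n) z → value (spread r x) + value (spread (opposite r) y) ≢ 2 * z
opposite-parities-odd r x y z eq = even≢odd z (suc (a + e)) (sym (begin
    suc (2 * suc (a + e))                     ≡⟨ cong (_+ 2 * suc (a + e)) (sym (parity-sum r)) ⟩
    (toℕ r + toℕ (opposite r)) + 2 * suc (a + e)
      ≡⟨ sym (regroup a e (toℕ r) (toℕ (opposite r))) ⟩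
    suc (2 * a + toℕ r) + suc (2 * e + toℕ (opposite r))
      ≡⟨ sym (cong₂ _+_ (cong suc (toℕ-spread r x)) (cong suc (toℕ-spread (opposite r) y))) ⟩
    value (spread r x) + value (spread (opposite r) y) ≡⟨ eq ⟩
    2 * z                                     ∎))
  where
  open ≡-Reasoning
  a e : ℕ
  a = toℕ x
  e = toℕ y
  regroup : ∀ a e r s → suc (2 * a + r) + suc (2 * e + s) ≡ (r + s) + 2 * suc (a + e)
  regroup = solve-∀

-- The gluing construction

glue : ∀ {n} → Fin 2 → Vec (Fin n) n → Vec (Fin n) n → Vec (Fin (n + n)) (n + n)
glue r p q = map (spread r) p ++ map (spread (opposite r)) q

glue-permutation : ∀ {n} r (p q : Vec (Fin n) n) → IsPermutation p → IsPermutation q →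
                   IsPermutation (glue r p q)
glue-permutation r p q p-perm q-perm rewrite toList-++ (map (spread r) p) (map (spread (opposite r)) q)
                                               | toList-map (spread r) p | toList-map (spread (opposite r)) q =
  Unique.++⁺ (Unique.map⁺ (proj₁ ∘ spread-injective) p-perm)
             (Unique.map⁺ (proj₁ ∘ spread-injective) q-perm)
             disjoint
  where
  disjoint : ∀ {v} → ¬ (v ∈ List.map (spread r) (toList p) × v ∈ List.map (spread (opposite r)) (toList q))
  disjoint (v∈p , v∈q) with ∈.∈-map⁻ (spread r) v∈p | ∈.∈-map⁻ (spread (opposite r)) v∈q
  ... | x , _ , refl | y , _ , eq = opposite-≢ r (proj₂ (spread-injective {r = r} {opposite r} {x} {y} eq))

glue-threeAPFree : ∀ {n} r (p q : Vec (Fin n) n) → ¬ HasThreeAP p → ¬ HasThreeAP q →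
                   ¬ HasThreeAP (glue r p q)
glue-threeAPFree r p q p-free q-free =
  [ p-free ∘ from-block r p , q-free ∘ from-block (opposite r) q ]
  ∘ APBy-++ value (map (spread r) p) (map (spread (opposite r)) q) cross
  where
  from-block : ∀ {n} s (v : Vec (Fin n) n) → APBy value (map (spread s) v) → HasThreeAP v
  from-block s v = APBy-reflect (value ∘ spread s) value (spread-reflects-AP s) v ∘ APBy-map value (spread s) v
  cross : ∀ i k z → value (lookup (map (spread r) p) i) + value (lookup (map (spread (opposite r)) q) k) ≢ 2 * z
  cross i k z rewrite lookup-map i (spread r) p | lookup-map k (spread (opposite r)) q =
    opposite-parities-odd r (lookup p i) (lookup q k) z

glue-threeFree : ∀ {n} r (p q : Vec (Fin n) n) → IsThreeFreePermutation p → IsThreeFreePermutation q →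
                 IsThreeFreePermutation (glue r p q)
glue-threeFree r p q (p-perm , p-free) (q-perm , q-free) =
  glue-permutation r p q p-perm q-perm , glue-threeAPFree r p q p-free q-free

map-injective : ∀ {A B : Set} {f g : A → B} → (∀ {a b} → f a ≡ g b → a ≡ b) →
                ∀ {m} {u v : Vec A m} → map f u ≡ map g v → u ≡ v
map-injective fg-inj {u = []} {[]} eq = refl
map-injective fg-inj {u = a ∷ u} {b ∷ v} eq =
  cong₂ _∷_ (fg-inj (proj₁ (∷-injective eq))) (map-injective fg-inj (proj₂ (∷-injective eq)))

-- For n ≥ 1 the glued permutation determines r (the parity of its first entry), p and q.
glue-injective : ∀ {n} {r s : Fin 2} {p q p′ q′ : Vec (Fin (suc n)) (suc n)} →
                 glue r p q ≡ glue s p′ q′ → (r , p , q) ≡ (s , p′ , q′)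
glue-injective {r = r} {s} {x ∷ p} {q} {y ∷ p′} {q′} eq =
  cong₂ _,_ r≡s (cong₂ _,_ p≡p′ q≡q′)
  where
  blocks≡ : map (spread r) (x ∷ p) ≡ map (spread s) (y ∷ p′) × map (spread (opposite r)) q ≡ map (spread (opposite s)) q′
  blocks≡ = ++-injective (map (spread r) (x ∷ p)) (map (spread s) (y ∷ p′)) eq
  r≡s : r ≡ s
  r≡s = proj₂ (spread-injective {r = r} {s} {x} {y} (∷-injectiveˡ eq))
  p≡p′ : x ∷ p ≡ y ∷ p′
  p≡p′ = map-injective (proj₁ ∘ spread-injective) (proj₁ blocks≡)
  q≡q′ : q ≡ q′
  q≡q′ = map-injective (proj₁ ∘ spread-injective) (proj₂ blocks≡)

-- The doubling inequality and its iteration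

doubling : ∀ {n} → 0 < n → 2 * (θ n * θ n) ≤ θ (n + n)
doubling {suc m} _ = begin
    2 * (θ n * θ n) ≡⟨ sym count ⟩
    length glued    ≤⟨ θ-lower-bound (n + n) glued-unique glued-threeFree ⟩
    θ (n + n)       ∎
  where
  open ≤-Reasoning
  n : ℕ
  n = suc m
  Triple : Set
  Triple = Fin 2 × Vec (Fin n) n × Vec (Fin n) n
  triples : List Triple
  triples = cartesianProduct (allFin 2) (cartesianProduct (threeFree n) (threeFree n))
  glueTriple : Triple → Vec (Fin (n + n)) (n + n)
  glueTriple (r , p , q) = glue r p q
  glued : List (Vec (Fin (n + n)) (n + n))
  glued = List.map glueTriple triples

  count : length glued ≡ 2 * (θ n * θ n)
  count = trans (ListP.length-map glueTriple triples)
    (trans (length-cartesianProductWith _,_ (allFin 2) (cartesianProduct (threeFree n) (threeFree n)))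
           (cong (2 *_) (length-cartesianProductWith _,_ (threeFree n) (threeFree n))))

  glued-unique : Unique glued
  glued-unique = Unique.map⁺ (λ {t} {t′} → glueTriple-injective t t′)
    (Unique.cartesianProduct⁺ (Unique.allFin⁺ 2)
      (Unique.cartesianProduct⁺ (threeFree-unique n) (threeFree-unique n)))
    where
    glueTriple-injective : ∀ t t′ → glueTriple t ≡ glueTriple t′ → t ≡ t′
    glueTriple-injective (r , p , q) (s , p′ , q′) = glue-injective

  glueTriple-threeFree : ∀ t → t ∈ triples → IsThreeFreePermutation (glueTriple t)
  glueTriple-threeFree (r , p , q) t∈ = glue-threeFree r p q (∈-threeFree⁻ p∈) (∈-threeFree⁻ q∈)
    where
    pq∈ : (p , q) ∈ cartesianProduct (threeFree n) (threeFree n)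
    pq∈ = proj₂ (∈.∈-cartesianProduct⁻ (allFin 2) (cartesianProduct (threeFree n) (threeFree n)) t∈)
    p∈ : p ∈ threeFree n
    p∈ = proj₁ (∈.∈-cartesianProduct⁻ (threeFree n) (threeFree n) pq∈)
    q∈ : q ∈ threeFree n
    q∈ = proj₂ (∈.∈-cartesianProduct⁻ (threeFree n) (threeFree n) pq∈)

  glued-threeFree : ∀ {v} → v ∈ glued → IsThreeFreePermutation v
  glued-threeFree v∈ =
    let t , t∈ , v≡glue-t = ∈.∈-map⁻ glueTriple v∈
    in subst IsThreeFreePermutation (sym v≡glue-t) (glueTriple-threeFree t t∈)

^-double : ∀ x e → x ^ (2 * e) ≡ x ^ e * x ^ e
^-double x e = trans (^-distribˡ-+-* x e (e + 0)) (cong (λ t → x ^ e * x ^ t) (+-identityʳ e))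

iterated-doubling : (f : ℕ → ℕ) → (∀ {n} → 0 < n → 2 * (f n * f n) ≤ f (n + n)) →
                    ∀ m → 0 < m → ∀ d → (2 * f m) ^ (2 ^ d) ≤ 2 * f (m * 2 ^ d)
iterated-doubling f f-doubling m m>0 zero = begin
    (2 * f m) ^ 1 ≡⟨ *-identityʳ (2 * f m) ⟩
    2 * f m       ≡⟨ cong (λ t → 2 * f t) (sym (*-identityʳ m)) ⟩
    2 * f (m * 1) ∎
  where open ≤-Reasoning
iterated-doubling f f-doubling m m>0 (suc d) = begin
    x ^ (2 * 2 ^ d)                 ≡⟨ ^-double x (2 ^ d) ⟩
    x ^ (2 ^ d) * x ^ (2 ^ d)       ≤⟨ *-mono-≤ ih ih ⟩
    (2 * f M) * (2 * f M)           ≡⟨ regroup (f M) ⟩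
    2 * (2 * (f M * f M))           ≤⟨ *-monoʳ-≤ 2 (f-doubling M>0) ⟩
    2 * f (M + M)                   ≡⟨ cong (λ t → 2 * f t) (twice m (2 ^ d)) ⟩
    2 * f (m * (2 * 2 ^ d))         ∎
  where
  open ≤-Reasoning
  x M : ℕ
  x = 2 * f m
  M = m * 2 ^ d
  ih : x ^ (2 ^ d) ≤ 2 * f M
  ih = iterated-doubling f f-doubling m m>0 d
  M>0 : 0 < M
  M>0 = *-mono-≤ m>0 (m^n>0 2 d)
  regroup : ∀ t → (2 * t) * (2 * t) ≡ 2 * (2 * (t * t))
  regroup = solve-∀
  twice : ∀ m e → m * e + m * e ≡ m * (2 * e)
  twice = solve-∀

bound-from-64 : (f : ℕ → ℕ) → (∀ {n} → 0 < n → 2 * (f n * f n) ≤ f (n + n)) →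
                (k : ℕ) → 6 ≤ k → (2 * f 64) ^ (2 ^ (k ∸ 6)) ≤ 2 * f (2 ^ k)
bound-from-64 f f-doubling k 6≤k = begin
    (2 * f 64) ^ (2 ^ (k ∸ 6)) ≤⟨ iterated-doubling f f-doubling 64 (s≤s z≤n) (k ∸ 6) ⟩
    2 * f (64 * 2 ^ (k ∸ 6))   ≡⟨ cong (λ t → 2 * f t) (sym 2^k≡64*2^[k∸6]) ⟩
    2 * f (2 ^ k)              ∎
  where
  open ≤-Reasoning
  2^k≡64*2^[k∸6] : 2 ^ k ≡ 64 * 2 ^ (k ∸ 6)
  2^k≡64*2^[k∸6] = trans (cong (2 ^_) (sym (m+[n∸m]≡n 6≤k))) (^-distribˡ-+-* 2 6 (k ∸ 6))

-- Theorem 3: for k ≥ 6, (2 θ(64))^(2^(k-6)) ≤ 2 θ(2^k), i.e. θ(2^k) ≥ c₃^(2^k) / 2.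
theorem3 : (k : ℕ) → 6 ≤ k → (2 * θ 64) ^ (2 ^ (k ∸ 6)) ≤ 2 * θ (2 ^ k)
theorem3 = bound-from-64 θ doubling
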